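{- Let $\alpha$ be an $n\times n$ permutation matrix and $w_\alpha=w_1\cdots w_n\in S_n$ the permutation with $\alpha_{w_i,i}=1$ for all $i$. Then the coefficient of $z^\alpha=z_{w_1,1}\cdots z_{w_n,n}$ in the bitableau $[P_\alpha\mid Q_\alpha]$ is $0$ if and only if the Schensted insertion of $w_\alpha$ produces a lateral bump.
   Context: Schensted insertion (French notation): insert $w_1,\dots,w_n$ successively into an initially empty tableau; a number $x$ inserted into a row is appended if it exceeds all entries (or the row is empty), otherwise it replaces the smallest entry $y>x$, and $y$ is bumped into the next row up and inserted by the same rule. A bump of $y$ from column $j$ is vertical if $y$ lands in column $j$ of the next row, and lateral otherwise. $P_\alpha$ is the resulting insertion tableau of $w_\alpha$; $Q_\alpha$ is the recording tableau, which has $i$ in the box newly created at step $i$. For standard Young tableaux $P,Q$ of the same shape $\lambda$, the bitableau is $[P\mid Q]=\prod_{j=1}^{\lambda_1}\Delta_j$, where $\Delta_j$ is the determinant of the submatrix of $(z_{i,k})_{i,k\ge1}$ with rows indexed by the entries of column $j$ of $P$ and columns indexed by the entries of column $j$ of $Q$. -}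

module Defs where

open import Data.Nat using (ℕ; zero; suc; _<ᵇ_; _≡ᵇ_; _+_)
open import Data.Bool using (Bool; true; false; _∨_; _∧_; if_then_else_; not)
open import Data.List using (List; []; _∷_; _++_; length; map; foldr; concatMap; upTo; zipWith)
open import Data.Maybe using (Maybe; just; nothing)
open import Data.Product using (_×_; _,_)
open import Data.Integer using (ℤ; +_; -_) renaming (_+_ to _+ℤ_; _*_ to _*ℤ_)
open import Data.Fin using (Fin; toℕ)
open import Data.Fin.Permutation using (Permutation′; _⟨$⟩ʳ_)
open import Data.List using (allFin)

-- Tableaux (French notation): a tableau is a list of rows, the head being
-- the bottom row; each row is listed left to right (column 0, 1, ...).

Tab : Set
Tab = List (List ℕ)

-- Returns (new row, column where x was placed, bumped entry if any).
rowInsert : ℕ → List ℕ → List ℕ × ℕ × Maybe ℕ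
rowInsert x [] = (x ∷ [] , 0 , nothing)
rowInsert x (y ∷ ys) with x <ᵇ y
... | true = (x ∷ ys , 0 , just y)
... | false with rowInsert x ys
...   | (r , p , b) = (y ∷ r , suc p , b)

-- Was the arrival of a bumped element (bumped from column j, if any)
-- at column p lateral?
lat : Maybe ℕ → ℕ → Bool
lat nothing p = false
lat (just j) p = not (j ≡ᵇ p)

-- Insert x (bumped from column 'prev' of the row below, or 'nothing' if
-- x is the inserted letter) into the rows rs.  Returns the new tableau,
-- the row index of the newly created box, and whether some bump during
-- this insertion was lateral.
ins : Maybe ℕ → ℕ → Tab → Tab × ℕ × Bool
ins prev x [] = ((x ∷ []) ∷ [] , 0 , lat prev 0)
ins prev x (r ∷ rs) with rowInsert x r
... | (r' , p , nothing) = (r' ∷ rs , 0 , lat prev p)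
... | (r' , p , just y) with ins (just p) y rs
...   | (rs' , k , l) = (r' ∷ rs' , suc k , lat prev p ∨ l)

addAt : ℕ → ℕ → Tab → Tab
addAt i zero [] = (i ∷ []) ∷ []
addAt i zero (r ∷ rs) = (r ++ (i ∷ [])) ∷ rs
addAt i (suc k) [] = (i ∷ []) ∷ []
addAt i (suc k) (r ∷ rs) = r ∷ addAt i k rs

schenstedGo : ℕ → List ℕ → Tab → Tab → Bool → Tab × Tab × Bool
schenstedGo i [] P Q b = (P , Q , b)
schenstedGo i (x ∷ xs) P Q b with ins nothing x P
... | (P' , k , l) = schenstedGo (suc i) xs P' (addAt i k Q) (b ∨ l)

schensted : List ℕ → Tab × Tab × Bool
schensted w = schenstedGo 1 w [] [] false

insTab : List ℕ → Tab
insTab w with schensted w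
... | (P , Q , b) = P

recTab : List ℕ → Tab
recTab w with schensted w
... | (P , Q , b) = Q

hasLateralBump : List ℕ → Bool
hasLateralBump w with schensted w
... | (P , Q , b) = b

-- Columns of a tableau (column j read bottom to top, hence increasing).

nth : ℕ → List ℕ → Maybe ℕ
nth j [] = nothing
nth zero (x ∷ xs) = just x
nth (suc j) (x ∷ xs) = nth j xs

column : ℕ → Tab → List ℕ
column j [] = []
column j (r ∷ rs) with nth j r
... | just x = x ∷ column j rs
... | nothing = column j rs

rowLen₁ : Tab → ℕ
rowLen₁ [] = 0
rowLen₁ (r ∷ _) = length r

columns : Tab → List (List ℕ)
columns T = map (λ j → column j T) (upTo (rowLen₁ T))

-- Polynomials in the variables z_{i,k} (i,k ≥ 1) with integer
-- coefficients, as formal sums of terms.  A monomial is a list of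
-- variables (i , k) (a multiset), a term is (coefficient , monomial).

Var : Set
Var = ℕ × ℕ

Monomial : Set
Monomial = List Var

Poly : Set
Poly = List (ℤ × Monomial)

onePoly : Poly
onePoly = (+ 1 , []) ∷ []

mulPoly : Poly → Poly → Poly
mulPoly p q = concatMap (λ { (a , m) → map (λ { (b , m') → (a *ℤ b , m ++ m') }) q }) p

eqVar : Var → Var → Bool
eqVar (a , b) (c , d) = (a ≡ᵇ c) ∧ (b ≡ᵇ d)

countVar : Var → Monomial → ℕ
countVar v [] = 0
countVar v (u ∷ m) = (if eqVar v u then 1 else 0) + countVar v m

allB : (Var → Bool) → List Var → Bool
allB f [] = true
allB f (v ∷ vs) = f v ∧ allB f vs

sameMon : Monomial → Monomial → Bool
sameMon m₁ m₂ = allB (λ v → countVar v m₁ ≡ᵇ countVar v m₂) (m₁ ++ m₂)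

coeff : Monomial → Poly → ℤ
coeff m [] = + 0
coeff m ((a , m') ∷ p) = (if sameMon m m' then a else + 0) +ℤ coeff m p

insEverywhere : ℕ → List ℕ → List (List ℕ)
insEverywhere x [] = (x ∷ []) ∷ []
insEverywhere x (y ∷ ys) = (x ∷ y ∷ ys) ∷ map (y ∷_) (insEverywhere x ys)

perms : List ℕ → List (List ℕ)
perms [] = [] ∷ []
perms (x ∷ xs) = concatMap (insEverywhere x) (perms xs)

countLess : ℕ → List ℕ → ℕ
countLess x [] = 0
countLess x (y ∷ ys) = (if y <ᵇ x then 1 else 0) + countLess x ys

inversions : List ℕ → ℕ
inversions [] = 0
inversions (x ∷ xs) = countLess x xs + inversions xs

signℕ : ℕ → ℤ
signℕ zero = + 1
signℕ (suc zero) = - (+ 1)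
signℕ (suc (suc n)) = signℕ n

nthD : List ℕ → ℕ → ℕ
nthD xs j with nth j xs
... | just x = x
... | nothing = 0

-- det of the submatrix of (z_{i,k}) with rows rs and columns cs
-- (|rs| = |cs|):  Σ_π sgn π ∏_b z_{rs_{π(b)}, cs_b}.
zipPairs : List ℕ → List ℕ → Monomial
zipPairs (a ∷ as) (b ∷ bs) = (a , b) ∷ zipPairs as bs
zipPairs _ _ = []

detSub : List ℕ → List ℕ → Poly
detSub rs cs =
  map (λ π → (signℕ (inversions π) , zipPairs (map (nthD rs) π) cs))
      (perms (upTo (length rs)))

bitableau : Tab → Tab → Poly
bitableau P Q = foldr mulPoly onePoly (zipWith detSub (columns P) (columns Q))

-- The permutation w_α (one-line notation, values 1..n) and z^α.

word : ∀ {n} → Permutation′ n → List ℕ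
word w = map (λ i → suc (toℕ (w ⟨$⟩ʳ i))) (allFin _)

zMon : ∀ {n} → Permutation′ n → Monomial
zMon w = map (λ i → (suc (toℕ (w ⟨$⟩ʳ i)) , suc (toℕ i))) (allFin _)

-- Write W for the word w_α.  Schensted insertion of W keeps an invariant relating P to Q.  While every
-- bump has been vertical, each column of P is the image under W of the same column of Q: the letter
-- inserted at step i climbs straight up to the column of the new box i.  Entries of P only ever move
-- weakly left, so once a lateral bump has carried some entry W m strictly left of the column of Q
-- containing m, W m never returns to that column or any column to its right.
-- On the polynomial side, the column indices of every monomial of [P | Q] are 1, ..., n, each once,
-- so such a monomial equals z^α exactly when all of its variables have the form z_{W k, k}.  That
-- condition is multiplicative, so the coefficient of z^α is the product over the columns j of the
-- corresponding coefficients of Δ_j.  Such a factor vanishes when W sends an entry of column j of Q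
-- outside column j of P, and is a nonzero multiple of a sign when W maps column j of Q onto column j
-- of P, because then only one permutation of the Leibniz expansion contributes.

module Submission where

open import Defs

open import Algebra.Properties.CommutativeSemigroup using (x∙yz≈y∙xz)
open import Data.Bool using (Bool; true; false; _∨_; _∧_; not; T; if_then_else_)
open import Data.Empty using (⊥-elim)
open import Data.Fin using (Fin; toℕ) renaming (zero to fzero; suc to fsuc)
open import Data.Fin.Properties using (toℕ-injective)
open import Data.Fin.Permutation using (Permutation′; _⟨$⟩ʳ_; _⟨$⟩ˡ_; inverseˡ)
open import Data.Integer using (ℤ; +_) renaming (_+_ to _+ℤ_; _*_ to _*ℤ_)
import Data.Integer.Properties as ℤ
open import Data.List
  using (List; []; _∷_; _++_; [_]; length; map; concat; foldr; zipWith; applyUpTo; upTo; tabulate; fromMaybe)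
open import Data.List.Properties
  using ( ++-assoc; ++-identityʳ; ∷-injective; length-++; length-map; length-upTo; length-tabulate
        ; map-cong; map-cong-local; map-++; map-∘; map-id-local; map-applyUpTo; applyUpTo-∷ʳ
        ; tabulate-cong; map-tabulate; zipWith-map )
open import Data.List.Membership.Propositional using (_∈_; _∉_)
open import Data.List.Membership.Propositional.Properties
  using ( ∈-++⁺ˡ; ∈-++⁺ʳ; ∈-++⁻; ∈-map⁺; ∈-map⁻; ∈-concat⁺′; ∈-concat⁻′; ∈-∃++
        ; ∈-upTo⁺; ∈-upTo⁻; ∈-applyUpTo⁻ )
open import Data.List.Relation.Unary.All as All using (All)
open import Data.List.Relation.Unary.All.Properties using () renaming (map⁺ to All-map⁺)
open import Data.List.Relation.Unary.AllPairs using ([]; _∷_)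
open import Data.List.Relation.Unary.Any using (here; there)
open import Data.List.Relation.Unary.Unique.Propositional using (Unique)
import Data.List.Relation.Unary.Unique.Propositional.Properties as Unique
open import Data.List.Relation.Binary.Permutation.Propositional
  using (_↭_; ↭-refl; ↭-sym; ↭-trans; ↭-reflexive; prep; swap; ↭⇒↭ₛ; module PermutationReasoning)
import Data.List.Relation.Binary.Permutation.Propositional as ↭
open import Data.List.Relation.Binary.Permutation.Propositional.Properties
  using (shift; shifts; ++-comm; ++⁺ˡ; ++⁺ʳ; ∈-resp-↭; map⁺; drop-mid; ↭-empty-inv; ↭-length)
open import Data.List.Relation.Binary.Permutation.Setoid.Properties using (Unique-resp-↭)
open import Data.Maybe using (Maybe; just; nothing)
open import Data.Maybe.Properties using (just-injective)
open import Data.Nat using (ℕ; zero; suc; _+_; pred; _≤_; _<_; z≤n; s≤s; _<ᵇ_; _≡ᵇ_; _<?_; _≟_)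
open import Data.Nat.Properties
open import Data.Product using (_×_; _,_; ∃; proj₁; proj₂)
open import Data.Sum using (_⊎_; inj₁; inj₂)
open import Data.Unit using (⊤; tt)
open import Function using (_∘_; id; case_of_; _⇔_; mk⇔)
open import Relation.Binary.PropositionalEquality hiding ([_])
open import Relation.Nullary using (¬_; yes; no)
open import Relation.Nullary.Reflects using (ofʸ; ofⁿ)

≡ᵇ-refl : ∀ n → (n ≡ᵇ n) ≡ true
≡ᵇ-refl zero    = refl
≡ᵇ-refl (suc n) = ≡ᵇ-refl n

≡ᵇ-true⇒≡ : ∀ m n → (m ≡ᵇ n) ≡ true → m ≡ n
≡ᵇ-true⇒≡ m n eq = ≡ᵇ⇒≡ m n (subst T (sym eq) tt)

∨-≡-false : ∀ {a b} → a ∨ b ≡ false → a ≡ false × b ≡ false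
∨-≡-false {false} {false} _ = refl , refl

∨-≡-true : ∀ {a b} → a ∨ b ≡ true → a ≡ true ⊎ b ≡ true
∨-≡-true {true}  _ = inj₁ refl
∨-≡-true {false} e = inj₂ e

nth-<-length : ∀ j (r : List ℕ) → j < length r → ∃ λ a → nth j r ≡ just a
nth-<-length zero    (x ∷ r) _         = x , refl
nth-<-length (suc j) (x ∷ r) (s≤s j<n) = nth-<-length j r j<n

nth-≥-length : ∀ j (r : List ℕ) → length r ≤ j → nth j r ≡ nothing
nth-≥-length j       []      _         = refl
nth-≥-length (suc j) (x ∷ r) (s≤s n≤j) = nth-≥-length j r n≤j

nth-just⇒< : ∀ j (r : List ℕ) {a} → nth j r ≡ just a → j < length r
nth-just⇒< zero    (x ∷ r) _  = s≤s z≤n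
nth-just⇒< (suc j) (x ∷ r) eq = s≤s (nth-just⇒< j r eq)

nth-just⇒∈ : ∀ j (r : List ℕ) {a} → nth j r ≡ just a → a ∈ r
nth-just⇒∈ zero    (x ∷ r) refl = here refl
nth-just⇒∈ (suc j) (x ∷ r) eq   = there (nth-just⇒∈ j r eq)

nth-++ˡ : ∀ j (r s : List ℕ) → j < length r → nth j (r ++ s) ≡ nth j r
nth-++ˡ zero    (x ∷ r) s _         = refl
nth-++ˡ (suc j) (x ∷ r) s (s≤s j<n) = nth-++ˡ j r s j<n

nth-length-++ : ∀ (r : List ℕ) x xs → nth (length r) (r ++ x ∷ xs) ≡ just x
nth-length-++ []      x xs = refl
nth-length-++ (y ∷ r) x xs = nth-length-++ r x xs

nth-∷ʳ-≢ : ∀ j (r : List ℕ) x → j ≢ length r → nth j (r ++ [ x ]) ≡ nth j r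
nth-∷ʳ-≢ zero    []      x j≢n = ⊥-elim (j≢n refl)
nth-∷ʳ-≢ (suc j) []      x _   = refl
nth-∷ʳ-≢ zero    (y ∷ r) x _   = refl
nth-∷ʳ-≢ (suc j) (y ∷ r) x j≢n = nth-∷ʳ-≢ j r x (j≢n ∘ cong suc)

column-∷ : ∀ j r rs → column j (r ∷ rs) ≡ fromMaybe (nth j r) ++ column j rs
column-∷ j r rs with nth j r
... | just x  = refl
... | nothing = refl

∈-column-∷⁻ : ∀ j r rs {v} → v ∈ column j (r ∷ rs) → nth j r ≡ just v ⊎ v ∈ column j rs
∈-column-∷⁻ j r rs m with nth j r
... | nothing = inj₂ m
... | just a with m
...   | here refl = inj₁ refl
...   | there m′  = inj₂ m′

∈-column-∷⁺ˡ : ∀ j r rs {v} → nth j r ≡ just v → v ∈ column j (r ∷ rs)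
∈-column-∷⁺ˡ j r rs eq rewrite eq = here refl

∈-column-∷⁺ʳ : ∀ j r rs {v} → v ∈ column j rs → v ∈ column j (r ∷ rs)
∈-column-∷⁺ʳ j r rs m with nth j r
... | nothing = m
... | just a  = there m

rowInsert-placed : ∀ x r {r′ p b} → rowInsert x r ≡ (r′ , p , b) → nth p r′ ≡ just x
rowInsert-placed x []       refl = refl
rowInsert-placed x (y ∷ ys) eq with x <ᵇ y
rowInsert-placed x (y ∷ ys) refl | true = refl
rowInsert-placed x (y ∷ ys) eq   | false with rowInsert x ys in e
rowInsert-placed x (y ∷ ys) refl | false | _ = rowInsert-placed x ys e

rowInsert-nth-≢ : ∀ x r {r′ p b} → rowInsert x r ≡ (r′ , p , b) →
                  ∀ j → j ≢ p → nth j r′ ≡ nth j r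
rowInsert-nth-≢ x []       refl zero    j≢p = ⊥-elim (j≢p refl)
rowInsert-nth-≢ x []       refl (suc j) _   = refl
rowInsert-nth-≢ x (y ∷ ys) eq   j       j≢p with x <ᵇ y
rowInsert-nth-≢ x (y ∷ ys) refl zero    j≢p | true = ⊥-elim (j≢p refl)
rowInsert-nth-≢ x (y ∷ ys) refl (suc j) _   | true = refl
rowInsert-nth-≢ x (y ∷ ys) eq   j       j≢p | false with rowInsert x ys in e
rowInsert-nth-≢ x (y ∷ ys) refl zero    _   | false | _ = refl
rowInsert-nth-≢ x (y ∷ ys) refl (suc j) j≢p | false | _ = rowInsert-nth-≢ x ys e j (j≢p ∘ cong suc)

rowInsert-left-≤ : ∀ x r {r′ p b} → rowInsert x r ≡ (r′ , p , b) →
                   ∀ j {a} → j < p → nth j r ≡ just a → a ≤ x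
rowInsert-left-≤ x (y ∷ ys) eq j j<p na with x <ᵇ y | <ᵇ-reflects-< x y
rowInsert-left-≤ x (y ∷ ys) refl j () na | true | _
rowInsert-left-≤ x (y ∷ ys) eq j j<p na | false | ofⁿ x≮y with rowInsert x ys in e
rowInsert-left-≤ x (y ∷ ys) refl zero    _         refl | false | ofⁿ x≮y | _ = ≮⇒≥ x≮y
rowInsert-left-≤ x (y ∷ ys) refl (suc j) (s≤s j<p) na   | false | ofⁿ x≮y | _ =
  rowInsert-left-≤ x ys e j j<p na

rowInsert-col-≤-length : ∀ x r {r′ p b} → rowInsert x r ≡ (r′ , p , b) → p ≤ length r
rowInsert-col-≤-length x []       refl = z≤n
rowInsert-col-≤-length x (y ∷ ys) eq with x <ᵇ y
rowInsert-col-≤-length x (y ∷ ys) refl | true = z≤n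
rowInsert-col-≤-length x (y ∷ ys) eq   | false with rowInsert x ys in e
rowInsert-col-≤-length x (y ∷ ys) refl | false | _ = s≤s (rowInsert-col-≤-length x ys e)

rowInsert-append : ∀ x r {r′ p} → rowInsert x r ≡ (r′ , p , nothing) →
                   r′ ≡ r ++ [ x ] × p ≡ length r
rowInsert-append x []       refl = refl , refl
rowInsert-append x (y ∷ ys) eq with x <ᵇ y
rowInsert-append x (y ∷ ys) () | true
rowInsert-append x (y ∷ ys) eq | false with rowInsert x ys in e
rowInsert-append x (y ∷ ys) refl | false | _ =
  let r′≡ , p≡ = rowInsert-append x ys e in cong (y ∷_) r′≡ , cong suc p≡

rowInsert-bump : ∀ x r {r′ p y} → rowInsert x r ≡ (r′ , p , just y) →
                 nth p r ≡ just y × x < y × (y ∷ r′ ↭ x ∷ r) × length r′ ≡ length r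
rowInsert-bump x (y ∷ ys) eq with x <ᵇ y | <ᵇ-reflects-< x y
rowInsert-bump x (y ∷ ys) refl | true | ofʸ x<y = refl , x<y , swap y x ↭-refl , refl
rowInsert-bump x (y ∷ ys) eq   | false | _ with rowInsert x ys in e
rowInsert-bump x (y ∷ ys) refl | false | _ | (_ , _ , just z) =
  let nz , x<z , z∷r↭x∷ys , len = rowInsert-bump x ys e in
  nz , x<z ,
  ↭-trans (swap z y ↭-refl) (↭-trans (prep y z∷r↭x∷ys) (swap y x ↭-refl)) ,
  cong suc len

-- This is why bumped entries move weakly left.
rowInsert-col-≤ : ∀ x r {r′ p b} c → rowInsert x r ≡ (r′ , p , b) →
                  (∀ z → nth c r ≡ just z → x < z) → p ≤ c
rowInsert-col-≤ x r c e x<r[c] with c <? length r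
... | yes c<n = let z , nz = nth-<-length c r c<n in
  ≮⇒≥ λ c<p → <⇒≱ (x<r[c] z nz) (rowInsert-left-≤ x r e c c<p nz)
... | no  c≮n = ≤-trans (rowInsert-col-≤-length x r e) (≮⇒≥ c≮n)

ColumnStrict : List ℕ → List ℕ → Set
ColumnStrict lower upper = ∀ j z → nth j upper ≡ just z → ∃ λ a → nth j lower ≡ just a × a < z

bottomRow : Tab → List ℕ
bottomRow []      = []
bottomRow (r ∷ _) = r

IsTableau : Tab → Set
IsTableau []       = ⊤
IsTableau (r ∷ rs) = ColumnStrict r (bottomRow rs) × IsTableau rs

-- prev = just c records that x was bumped out of column c of the row beneath T.
BumpedFrom : Maybe ℕ → ℕ → Tab → Set
BumpedFrom nothing  x T = ⊤
BumpedFrom (just c) x T = ∀ z → nth c (bottomRow T) ≡ just z → x < z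

SupportsUpTo : List ℕ → ℕ → ℕ → Set
SupportsUpTo lower c x = ∀ j → j ≤ c → ∃ λ a → nth j lower ≡ just a × a < x

rowInsert-columnStrict : ∀ x r {r′ p b} lower c → rowInsert x r ≡ (r′ , p , b) →
  ColumnStrict lower r → SupportsUpTo lower c x → p ≤ c → ColumnStrict lower r′
rowInsert-columnStrict x r {p = p} lower c e strict supp p≤c j z nz with j ≟ p
... | yes refl =
  let a , na , a<x = supp j p≤c in
  a , na , subst (a <_) (just-injective (trans (sym (rowInsert-placed x r e)) nz)) a<x
... | no j≢p = strict j z (trans (sym (rowInsert-nth-≢ x r e j j≢p)) nz)

ins-bottomRow-columnStrict : ∀ prev x T {T′ k l} → BumpedFrom prev x T →
  ins prev x T ≡ (T′ , k , l) →
  ∀ c lower → prev ≡ just c → ColumnStrict lower (bottomRow T) → SupportsUpTo lower c x →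
  ColumnStrict lower (bottomRow T′)
ins-bottomRow-columnStrict prev x [] _ refl c lower _ _ supp zero z refl = supp zero z≤n
ins-bottomRow-columnStrict prev x (r ∷ rs) bumped eq c lower refl strict supp with rowInsert x r in e
ins-bottomRow-columnStrict prev x (r ∷ rs) bumped refl c lower refl strict supp | (_ , _ , nothing) =
  rowInsert-columnStrict x r lower c e strict supp (rowInsert-col-≤ x r c e bumped)
ins-bottomRow-columnStrict prev x (r ∷ rs) bumped eq c lower refl strict supp | (_ , p , just y)
  with ins (just p) y rs
ins-bottomRow-columnStrict prev x (r ∷ rs) bumped refl c lower refl strict supp | (_ , p , just y) | _ =
  rowInsert-columnStrict x r lower c e strict supp (rowInsert-col-≤ x r c e bumped)

bumped-from-tableau : ∀ r rs {c y} → IsTableau (r ∷ rs) → nth c r ≡ just y →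
                      BumpedFrom (just c) y rs
bumped-from-tableau r rs (strict , _) ny z nz =
  let a , na , a<z = strict _ z nz in subst (_< z) (just-injective (trans (sym na) ny)) a<z

rowInsert-below : ∀ x r {r′ p b} upper → rowInsert x r ≡ (r′ , p , b) → ColumnStrict r upper →
  (∀ z → nth p upper ≡ just z → x < z) → ColumnStrict r′ upper
rowInsert-below x r {p = p} upper e strict x<upper[p] j z nz with j ≟ p
... | yes refl = x , rowInsert-placed x r e , x<upper[p] z nz
... | no j≢p = let a , na , a<z = strict j z nz in a , trans (rowInsert-nth-≢ x r e j j≢p) na , a<z

rowInsert-supportsUpTo : ∀ x r {r′ p y} → rowInsert x r ≡ (r′ , p , just y) → SupportsUpTo r′ p y
rowInsert-supportsUpTo x r {p = p} e j j≤p with j ≟ p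
... | yes refl = x , rowInsert-placed x r e , proj₁ (proj₂ (rowInsert-bump x r e))
... | no j≢p =
  let j<p = ≤∧≢⇒< j≤p j≢p
      a , na = nth-<-length j r (<-≤-trans j<p (rowInsert-col-≤-length x r e))
  in a , trans (rowInsert-nth-≢ x r e j j≢p) na ,
     ≤-<-trans (rowInsert-left-≤ x r e j j<p na) (proj₁ (proj₂ (rowInsert-bump x r e)))

ins-tableau : ∀ prev x T {T′ k l} → IsTableau T → BumpedFrom prev x T →
              ins prev x T ≡ (T′ , k , l) → IsTableau T′
ins-tableau prev x [] _ _ refl = (λ _ _ ()) , tt
ins-tableau prev x (r ∷ rs) tab bumped eq with rowInsert x r in e
ins-tableau prev x (r ∷ rs) (strict , tab) bumped refl | (_ , _ , nothing) =
  rowInsert-below x r (bottomRow rs) e strict nothing-above , tab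
  where
  nothing-above : ∀ z → nth _ (bottomRow rs) ≡ just z → x < z
  nothing-above z nz with strict _ z nz
  ... | _ , na , _
    with trans (sym na) (nth-≥-length _ r (≤-reflexive (sym (proj₂ (rowInsert-append x r e)))))
  ... | ()
ins-tableau prev x (r ∷ rs) tab bumped eq | (_ , p , just y) with ins (just p) y rs in e₂
ins-tableau prev x (r ∷ rs) tab bumped refl | (r′ , p , just y) | _ =
  ins-bottomRow-columnStrict (just p) y rs bumped′ e₂ p r′ refl
    (rowInsert-below x r (bottomRow rs) e (proj₁ tab) (λ z nz → <-trans x<y (bumped′ z nz)))
    (rowInsert-supportsUpTo x r e) ,
  ins-tableau (just p) y rs (proj₂ tab) bumped′ e₂
  where
  bumped′ : BumpedFrom (just p) y rs
  bumped′ = bumped-from-tableau r rs tab (proj₁ (rowInsert-bump x r e))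
  x<y : x < y
  x<y = proj₁ (proj₂ (rowInsert-bump x r e))

-- Movement of entries under insertion

CameFromRight : Maybe ℕ → ℕ → Tab → ℕ → ℕ → Set
CameFromRight prev x T j v =
  (v ≡ x × (∀ c → prev ≡ just c → j ≤ c)) ⊎ (∃ λ j′ → j ≤ j′ × v ∈ column j′ T)

rowInsert-nth-just : ∀ x r {r′ p b} → rowInsert x r ≡ (r′ , p , b) →
  ∀ j {v} → nth j r′ ≡ just v → (v ≡ x × j ≡ p) ⊎ nth j r ≡ just v
rowInsert-nth-just x r {p = p} e j nv with j ≟ p
... | yes refl = inj₁ (just-injective (trans (sym nv) (rowInsert-placed x r e)) , refl)
... | no j≢p   = inj₂ (trans (sym (rowInsert-nth-≢ x r e j j≢p)) nv)

rowInsert-cameFromRight : ∀ prev x r rs {r′ p b} → BumpedFrom prev x (r ∷ rs) →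
  rowInsert x r ≡ (r′ , p , b) →
  ∀ j {v} → nth j r′ ≡ just v → CameFromRight prev x (r ∷ rs) j v
rowInsert-cameFromRight prev x r rs bumped e j nv with rowInsert-nth-just x r e j nv
... | inj₁ (refl , refl) = inj₁ (refl , λ { c refl → rowInsert-col-≤ x r c e bumped })
... | inj₂ nv′ = inj₂ (j , ≤-refl , ∈-column-∷⁺ˡ j r rs nv′)

ins-cameFromRight : ∀ prev x T {T′ k l} → IsTableau T → BumpedFrom prev x T →
  ins prev x T ≡ (T′ , k , l) →
  ∀ j {v} → v ∈ column j T′ → CameFromRight prev x T j v
ins-cameFromRight prev x [] _ _ refl zero (here refl) = inj₁ (refl , λ _ _ → z≤n)
ins-cameFromRight prev x (r ∷ rs) tab bumped eq j m with rowInsert x r in e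
ins-cameFromRight prev x (r ∷ rs) tab bumped refl j m | (r′ , _ , nothing)
  with ∈-column-∷⁻ j r′ rs m
... | inj₁ nv = rowInsert-cameFromRight prev x r rs bumped e j nv
... | inj₂ m′ = inj₂ (j , ≤-refl , ∈-column-∷⁺ʳ j r rs m′)
ins-cameFromRight prev x (r ∷ rs) tab bumped eq j m | (_ , p , just y) with ins (just p) y rs in e₂
ins-cameFromRight prev x (r ∷ rs) tab bumped refl j m | (r′ , p , just y) | (rs′ , _ , _)
  with ∈-column-∷⁻ j r′ rs′ m
... | inj₁ nv = rowInsert-cameFromRight prev x r rs bumped e j nv
... | inj₂ m′ with ins-cameFromRight (just p) y rs (proj₂ tab) bumped′ e₂ j m′
  where
  bumped′ : BumpedFrom (just p) y rs
  bumped′ = bumped-from-tableau r rs tab (proj₁ (rowInsert-bump x r e))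
...   | inj₁ (refl , j≤c) =
  inj₂ (p , j≤c p refl , ∈-column-∷⁺ˡ p r rs (proj₁ (rowInsert-bump x r e)))
...   | inj₂ (j′ , j≤j′ , m″) = inj₂ (j′ , j≤j′ , ∈-column-∷⁺ʳ j′ r rs m″)

lat-true⇒≢ : ∀ prev p → lat prev p ≡ true → ∃ λ c → prev ≡ just c × c ≢ p
lat-true⇒≢ (just c) p e with c ≡ᵇ p in c≡ᵇp
lat-true⇒≢ (just c) p () | true
... | false = c , refl , λ { refl → case trans (sym c≡ᵇp) (≡ᵇ-refl c) of λ () }

lat-false⇒≡ : ∀ {c} p → lat (just c) p ≡ false → c ≡ p
lat-false⇒≡ {c} p e with c ≡ᵇ p in c≡ᵇp
... | true = ≡ᵇ-true⇒≡ c p c≡ᵇp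
lat-false⇒≡ p () | false

lateral-arrival : ∀ prev x r {r′ p b} rs → BumpedFrom prev x (r ∷ rs) →
  rowInsert x r ≡ (r′ , p , b) →
  lat prev p ≡ true → ∃ λ c → prev ≡ just c × p < c
lateral-arrival prev x r rs bumped e lateral with lat-true⇒≢ prev _ lateral
... | c , refl , c≢p = c , refl , ≤∧≢⇒< (rowInsert-col-≤ x r c e bumped) (c≢p ∘ sym)

ins-lateral-moves-left : ∀ prev x T {T′ k l} → IsTableau T → BumpedFrom prev x T →
  ins prev x T ≡ (T′ , k , l) → l ≡ true →
  (∃ λ c → prev ≡ just c × ∃ λ q → q < c × x ∈ column q T′) ⊎
  (∃ λ y → ∃ λ c → ∃ λ q → q < c × y ∈ column c T × y ∈ column q T′)
ins-lateral-moves-left prev x [] _ _ refl lateral with lat-true⇒≢ prev 0 lateral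
... | c , prev≡c , c≢0 = inj₁ (c , prev≡c , 0 , n≢0⇒n>0 c≢0 , here refl)
ins-lateral-moves-left prev x (r ∷ rs) tab bumped eq lateral with rowInsert x r in e
ins-lateral-moves-left prev x (r ∷ rs) tab bumped refl lateral | (r′ , p , nothing) =
  let c , prev≡c , p<c = lateral-arrival prev x r rs bumped e lateral in
  inj₁ (c , prev≡c , p , p<c , ∈-column-∷⁺ˡ p r′ rs (rowInsert-placed x r e))
ins-lateral-moves-left prev x (r ∷ rs) tab bumped eq lateral | (_ , p , just y) with ins (just p) y rs in e₂
ins-lateral-moves-left prev x (r ∷ rs) tab bumped refl lateral | (r′ , p , just y) | (rs′ , _ , _)
  with ∨-≡-true {lat prev p} lateral
... | inj₁ here-lateral =
  let c , prev≡c , p<c = lateral-arrival prev x r rs bumped e here-lateral in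
  inj₁ (c , prev≡c , p , p<c , ∈-column-∷⁺ˡ p r′ rs′ (rowInsert-placed x r e))
... | inj₂ later-lateral with ins-lateral-moves-left (just p) y rs (proj₂ tab) bumped′ e₂ later-lateral
  where
  bumped′ : BumpedFrom (just p) y rs
  bumped′ = bumped-from-tableau r rs tab (proj₁ (rowInsert-bump x r e))
...   | inj₁ (_ , refl , q , q<p , y∈q) =
  inj₂ (y , p , q , q<p , ∈-column-∷⁺ˡ p r rs (proj₁ (rowInsert-bump x r e)) ,
        ∈-column-∷⁺ʳ q r′ rs′ y∈q)
...   | inj₂ (z , c , q , q<c , z∈c , z∈q) =
  inj₂ (z , c , q , q<c , ∈-column-∷⁺ʳ c r rs z∈c , ∈-column-∷⁺ʳ q r′ rs′ z∈q)

rowLen : ℕ → Tab → ℕ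
rowLen k       []       = 0
rowLen zero    (r ∷ _)  = length r
rowLen (suc k) (_ ∷ rs) = rowLen k rs

column-new-row : ∀ x j → j ≢ 0 → column j ((x ∷ []) ∷ []) ≡ []
column-new-row x zero    j≢0 = ⊥-elim (j≢0 refl)
column-new-row x (suc j) _   = refl

ins-vertical : ∀ prev x T {T′ k l} → ins prev x T ≡ (T′ , k , l) → l ≡ false →
  ∃ λ a → (∀ c → prev ≡ just c → c ≡ a) × (column a T′ ↭ x ∷ column a T) ×
          (∀ j → j ≢ a → column j T′ ≡ column j T) × rowLen k T ≡ a
ins-vertical prev x [] refl vertical =
  0 , (λ { c refl → lat-false⇒≡ 0 vertical }) , ↭-refl , column-new-row x , refl
ins-vertical prev x (r ∷ rs) eq vertical with rowInsert x r in e
ins-vertical prev x (r ∷ rs) refl vertical | (r′ , p , nothing) =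
  p , (λ { c refl → lat-false⇒≡ p vertical }) , column-p , column-j , sym p≡n
  where
  p≡n : p ≡ length r
  p≡n = proj₂ (rowInsert-append x r e)
  column-p : column p (r′ ∷ rs) ↭ x ∷ column p (r ∷ rs)
  column-p rewrite column-∷ p r′ rs | column-∷ p r rs | rowInsert-placed x r e
    | nth-≥-length p r (≤-reflexive (sym p≡n)) = ↭-refl
  column-j : ∀ j → j ≢ p → column j (r′ ∷ rs) ≡ column j (r ∷ rs)
  column-j j j≢p rewrite column-∷ j r′ rs | column-∷ j r rs | rowInsert-nth-≢ x r e j j≢p = refl
ins-vertical prev x (r ∷ rs) eq vertical | (_ , p , just y) with ins (just p) y rs in e₂
ins-vertical prev x (r ∷ rs) refl vertical | (r′ , p , just y) | (rs′ , _ , _)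
  with ∨-≡-false {lat prev p} vertical
... | here-vertical , later-vertical with ins-vertical (just p) y rs e₂ later-vertical
... | a , p≡a , column-a , column-j , rowLen≡a with p≡a p refl
... | refl = p , (λ { c refl → lat-false⇒≡ p here-vertical }) , column-p , column-j′ , rowLen≡a
  where
  column-p : column p (r′ ∷ rs′) ↭ x ∷ column p (r ∷ rs)
  column-p rewrite column-∷ p r′ rs′ | column-∷ p r rs | rowInsert-placed x r e
    | proj₁ (rowInsert-bump x r e) = prep x column-a
  column-j′ : ∀ j → j ≢ p → column j (r′ ∷ rs′) ≡ column j (r ∷ rs)
  column-j′ j j≢p rewrite column-∷ j r′ rs′ | column-∷ j r rs | rowInsert-nth-≢ x r e j j≢p
    | column-j j j≢p = refl

ins-content : ∀ prev x T {T′ k l} → ins prev x T ≡ (T′ , k , l) → concat T′ ↭ x ∷ concat T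
ins-content prev x [] refl = ↭-refl
ins-content prev x (r ∷ rs) eq with rowInsert x r in e
ins-content prev x (r ∷ rs) refl | (_ , _ , nothing) rewrite proj₁ (rowInsert-append x r e)
  | ++-assoc r [ x ] (concat rs) = shift x r (concat rs)
ins-content prev x (r ∷ rs) eq | (_ , p , just y) with ins (just p) y rs in e₂
ins-content prev x (r ∷ rs) refl | (r′ , p , just y) | _ =
  ↭-trans (++⁺ˡ r′ (ins-content (just p) y rs e₂))
    (↭-trans (shift y r′ (concat rs))
      (++⁺ʳ (concat rs) (proj₁ (proj₂ (proj₂ (rowInsert-bump x r e))))))

growRow : ℕ → List ℕ → List ℕ
growRow zero    []       = 1 ∷ []
growRow zero    (a ∷ as) = suc a ∷ as
growRow (suc k) []       = 1 ∷ []
growRow (suc k) (a ∷ as) = a ∷ growRow k as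

length-∷ʳ : ∀ (r : List ℕ) x → length (r ++ [ x ]) ≡ suc (length r)
length-∷ʳ r x = trans (length-++ r) (+-comm (length r) 1)

ins-shape : ∀ prev x T {T′ k l} → ins prev x T ≡ (T′ , k , l) →
            map length T′ ≡ growRow k (map length T)
ins-shape prev x [] refl = refl
ins-shape prev x (r ∷ rs) eq with rowInsert x r in e
ins-shape prev x (r ∷ rs) refl | (_ , _ , nothing) rewrite proj₁ (rowInsert-append x r e) =
  cong (_∷ map length rs) (length-∷ʳ r x)
ins-shape prev x (r ∷ rs) eq | (_ , p , just y) with ins (just p) y rs in e₂
ins-shape prev x (r ∷ rs) refl | (_ , p , just y) | _ =
  cong₂ _∷_ (proj₂ (proj₂ (proj₂ (rowInsert-bump x r e)))) (ins-shape (just p) y rs e₂)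

-- The Schensted invariant

addAt-column : ∀ i k Q → (column (rowLen k Q) (addAt i k Q) ↭ i ∷ column (rowLen k Q) Q) ×
  (∀ j → j ≢ rowLen k Q → column j (addAt i k Q) ≡ column j Q)
addAt-column i zero    []       = ↭-refl , column-new-row i
addAt-column i (suc k) []       = ↭-refl , column-new-row i
addAt-column i zero    (r ∷ rs) = column-n , column-j
  where
  column-n : column (length r) ((r ++ [ i ]) ∷ rs) ↭ i ∷ column (length r) (r ∷ rs)
  column-n rewrite column-∷ (length r) (r ++ [ i ]) rs | column-∷ (length r) r rs | nth-length-++ r i []
    | nth-≥-length (length r) r ≤-refl = ↭-refl
  column-j : ∀ j → j ≢ length r → column j ((r ++ [ i ]) ∷ rs) ≡ column j (r ∷ rs)
  column-j j j≢n rewrite column-∷ j (r ++ [ i ]) rs | column-∷ j r rs | nth-∷ʳ-≢ j r i j≢n = refl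
addAt-column i (suc k) (r ∷ rs) = column-a , column-j
  where
  a : ℕ
  a = rowLen k rs
  column-a : column a (r ∷ addAt i k rs) ↭ i ∷ column a (r ∷ rs)
  column-a rewrite column-∷ a r (addAt i k rs) | column-∷ a r rs =
    ↭-trans (++⁺ˡ (fromMaybe (nth a r)) (proj₁ (addAt-column i k rs)))
      (shift i (fromMaybe (nth a r)) (column a rs))
  column-j : ∀ j → j ≢ a → column j (r ∷ addAt i k rs) ≡ column j (r ∷ rs)
  column-j j j≢a rewrite column-∷ j r (addAt i k rs) | column-∷ j r rs
    | proj₂ (addAt-column i k rs) j j≢a = refl

column-⊆-addAt : ∀ i k Q j {v} → v ∈ column j Q → v ∈ column j (addAt i k Q)
column-⊆-addAt i k Q j m with j ≟ rowLen k Q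
... | yes refl = ∈-resp-↭ (↭-sym (proj₁ (addAt-column i k Q))) (there m)
... | no j≢a rewrite proj₂ (addAt-column i k Q) j j≢a = m

addAt-content : ∀ i k Q → concat (addAt i k Q) ↭ i ∷ concat Q
addAt-content i zero    []       = ↭-refl
addAt-content i (suc k) []       = ↭-refl
addAt-content i zero    (r ∷ rs) rewrite ++-assoc r [ i ] (concat rs) = shift i r (concat rs)
addAt-content i (suc k) (r ∷ rs) = ↭-trans (++⁺ˡ r (addAt-content i k rs)) (shift i r (concat rs))

addAt-shape : ∀ i k Q → map length (addAt i k Q) ≡ growRow k (map length Q)
addAt-shape i zero    []       = refl
addAt-shape i (suc k) []       = refl
addAt-shape i zero    (r ∷ rs) = cong (_∷ map length rs) (length-∷ʳ r i)
addAt-shape i (suc k) (r ∷ rs) = cong (length r ∷_) (addAt-shape i k rs)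

rowLen-sameShape : ∀ k (T T′ : Tab) → map length T ≡ map length T′ → rowLen k T ≡ rowLen k T′
rowLen-sameShape k       []       []        _  = refl
rowLen-sameShape zero    (r ∷ T)  (r′ ∷ T′) eq = proj₁ (∷-injective eq)
rowLen-sameShape (suc k) (r ∷ T)  (r′ ∷ T′) eq = rowLen-sameShape k T T′ (proj₂ (∷-injective eq))

unique-↭ : ∀ {xs ys : List ℕ} → xs ↭ ys → Unique xs → Unique ys
unique-↭ p = Unique-resp-↭ (setoid ℕ) (↭⇒↭ₛ p)

unique-++ˡ : ∀ (xs : List ℕ) {ys} → Unique (xs ++ ys) → Unique xs
unique-++ˡ []       _          = []
unique-++ˡ (x ∷ xs) (x∉ ∷ uxs) =
  All.tabulate (λ m → All.lookup x∉ (∈-++⁺ˡ m)) ∷ unique-++ˡ xs uxs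

unique-++ʳ : ∀ (xs : List ℕ) {ys} → Unique (xs ++ ys) → Unique ys
unique-++ʳ []       u         = u
unique-++ʳ (x ∷ xs) (_ ∷ uxs) = unique-++ʳ xs uxs

unique-++-disjoint : ∀ (xs : List ℕ) {ys v} → Unique (xs ++ ys) → v ∈ xs → v ∉ ys
unique-++-disjoint (x ∷ xs) (x∉ ∷ _) (here refl) m = All.lookup x∉ (∈-++⁺ʳ xs m) refl
unique-++-disjoint (x ∷ xs) (_ ∷ u)  (there m′)  m = unique-++-disjoint xs u m′ m

nth-injective : ∀ (r : List ℕ) a b {v} → Unique r → nth a r ≡ just v → nth b r ≡ just v → a ≡ b
nth-injective (x ∷ r) zero    zero    _        _    _    = refl
nth-injective (x ∷ r) zero    (suc b) (x∉ ∷ _) refl nb   = ⊥-elim (All.lookup x∉ (nth-just⇒∈ b r nb) refl)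
nth-injective (x ∷ r) (suc a) zero    (x∉ ∷ _) na   refl = ⊥-elim (All.lookup x∉ (nth-just⇒∈ a r na) refl)
nth-injective (x ∷ r) (suc a) (suc b) (_ ∷ u)  na   nb   = cong suc (nth-injective r a b u na nb)

column-⊆-concat : ∀ j T {v} → v ∈ column j T → v ∈ concat T
column-⊆-concat j (r ∷ rs) m with ∈-column-∷⁻ j r rs m
... | inj₁ nv = ∈-++⁺ˡ (nth-just⇒∈ j r nv)
... | inj₂ m′ = ∈-++⁺ʳ r (column-⊆-concat j rs m′)

column-unique : ∀ T a b {v} → Unique (concat T) → v ∈ column a T → v ∈ column b T → a ≡ b
column-unique (r ∷ rs) a b u ma mb with ∈-column-∷⁻ a r rs ma | ∈-column-∷⁻ b r rs mb
... | inj₁ na  | inj₁ nb  = nth-injective r a b (unique-++ˡ r u) na nb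
... | inj₁ na  | inj₂ mb′ = ⊥-elim (unique-++-disjoint r u (nth-just⇒∈ a r na) (column-⊆-concat b rs mb′))
... | inj₂ ma′ | inj₁ nb  = ⊥-elim (unique-++-disjoint r u (nth-just⇒∈ b r nb) (column-⊆-concat a rs ma′))
... | inj₂ ma′ | inj₂ mb′ = column-unique rs a b (unique-++ʳ r u) ma′ mb′

unique-column : ∀ j T → Unique (concat T) → Unique (column j T)
unique-column j []       u = []
unique-column j (r ∷ rs) u with nth j r in nj
... | nothing = unique-column j rs (unique-++ʳ r u)
... | just a  =
  All.tabulate (λ { m refl → unique-++-disjoint r u (nth-just⇒∈ j r nj) (column-⊆-concat j rs m) })
  ∷ unique-column j rs (unique-++ʳ r u)

Obstruction : (ℕ → ℕ) → Tab → Tab → Set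
Obstruction W P Q = ∃ λ c → ∃ λ m → m ∈ column c Q × (∀ j → c ≤ j → W m ∉ column j P)

columnsAgree-ins-vertical : ∀ (W : ℕ → ℕ) x i {P Q P′ k} → map length P ≡ map length Q →
  W i ≡ x →
  ins nothing x P ≡ (P′ , k , false) → (∀ j → map W (column j Q) ↭ column j P) →
  ∀ j → map W (column j (addAt i k Q)) ↭ column j P′
columnsAgree-ins-vertical W x i {P} {Q} {k = k} shape Wi≡x e agree j
  with ins-vertical nothing x P e refl
... | a , _ , column-a , column-j , rowLen≡a with trans (rowLen-sameShape k Q P (sym shape)) rowLen≡a
... | refl with j ≟ rowLen k Q
...   | yes refl = ↭-trans (map⁺ W (proj₁ (addAt-column i k Q)))
                   (subst (λ w → w ∷ _ ↭ _) (sym Wi≡x)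
                     (↭-trans (prep x (agree j)) (↭-sym column-a)))
...   | no j≢a rewrite proj₂ (addAt-column i k Q) j j≢a | column-j j j≢a = agree j

obstruction-ins : ∀ (W : ℕ → ℕ) x i {P Q P′ k l} → IsTableau P →
  ins nothing x P ≡ (P′ , k , l) →
  (∀ m → m ∈ concat Q → W m ≢ x) → Obstruction W P Q → Obstruction W P′ (addAt i k Q)
obstruction-ins W x i {P} {Q} {P′} {k} tab e fresh (c , m , m∈c , absent) =
  c , m , column-⊆-addAt i k Q c m∈c , absent′
  where
  absent′ : ∀ j → c ≤ j → W m ∉ column j P′
  absent′ j c≤j Wm∈j with ins-cameFromRight nothing x P tab tt e j Wm∈j
  ... | inj₁ (Wm≡x , _) = fresh m (column-⊆-concat c Q m∈c) Wm≡x
  ... | inj₂ (j′ , j≤j′ , Wm∈j′) = absent j′ (≤-trans c≤j j≤j′) Wm∈j′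

-- The entry moved strictly left by a lateral bump now lies left of its old column, and nowhere else.
obstruction-ins-lateral : ∀ (W : ℕ → ℕ) x i {P Q P′ k} → IsTableau P → Unique (concat P′) →
  ins nothing x P ≡ (P′ , k , true) → (∀ j → map W (column j Q) ↭ column j P) →
  Obstruction W P′ (addAt i k Q)
obstruction-ins-lateral W x i {P} {Q} {P′} {k} tab u e agree
  with ins-lateral-moves-left nothing x P tab tt e refl
... | inj₁ (_ , () , _)
... | inj₂ (y , c , q , q<c , y∈c , y∈q) with ∈-map⁻ W (∈-resp-↭ (↭-sym (agree c)) y∈c)
... | m , m∈c , refl = c , m , column-⊆-addAt i k Q c m∈c ,
  λ j c≤j Wm∈j → <⇒≱ q<c (subst (c ≤_) (column-unique P′ j q u Wm∈j y∈q) c≤j)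

letter : List ℕ → ℕ → ℕ
letter ws k = nthD ws (pred k)

nthD-just : ∀ (xs : List ℕ) j {a} → nth j xs ≡ just a → nthD xs j ≡ a
nthD-just xs j eq rewrite eq = refl

letter-next : ∀ (pre : List ℕ) x xs → letter (pre ++ x ∷ xs) (suc (length pre)) ≡ x
letter-next pre x xs = nthD-just (pre ++ x ∷ xs) (length pre) (nth-length-++ pre x xs)

letter-prefix : ∀ (pre ys : List ℕ) {m} → m ∈ applyUpTo suc (length pre) →
                letter (pre ++ ys) m ∈ pre
letter-prefix pre ys m∈ with ∈-applyUpTo⁻ suc m∈
... | t , t<n , refl =
  let a , na = nth-<-length t pre t<n in
  subst (_∈ pre) (sym (nthD-just (pre ++ ys) t (trans (nth-++ˡ t pre ys t<n) na))) (nth-just⇒∈ t pre na)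

record Invariant (ws pre : List ℕ) (P Q : Tab) (lateral : Bool) : Set where
  field
    tableau      : IsTableau P
    sameShape    : map length P ≡ map length Q
    contentP     : concat P ↭ pre
    contentQ     : concat Q ↭ applyUpTo suc (length pre)
    columnsAgree : lateral ≡ false → ∀ j → map (letter ws) (column j Q) ↭ column j P
    obstruction  : lateral ≡ true → Obstruction (letter ws) P Q

invariant-start : ∀ ws → Invariant ws [] [] [] false
invariant-start ws = record
  { tableau = tt ; sameShape = refl ; contentP = ↭-refl ; contentQ = ↭-refl
  ; columnsAgree = λ _ _ → ↭-refl ; obstruction = λ () }

invariant-step : ∀ ws pre x xs {P Q b P′ k l} → ws ≡ pre ++ x ∷ xs → Unique ws →
  Invariant ws pre P Q b → ins nothing x P ≡ (P′ , k , l) →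
  Invariant ws (pre ++ [ x ]) P′ (addAt (suc (length pre)) k Q) (b ∨ l)
invariant-step ws pre x xs {P} {Q} {b} {P′} {k} {l} refl u inv e = record
  { tableau = ins-tableau nothing x P tableau tt e
  ; sameShape = trans (ins-shape nothing x P e) (trans (cong (growRow k) sameShape) (sym (addAt-shape i k Q)))
  ; contentP = contentP′
  ; contentQ = contentQ′
  ; columnsAgree = columnsAgree′ b l refl refl
  ; obstruction = obstruction′ b l refl refl
  }
  where
  open Invariant inv
  i : ℕ
  i = suc (length pre)
  contentP′ : concat P′ ↭ pre ++ [ x ]
  contentP′ = ↭-trans (ins-content nothing x P e) (↭-trans (prep x contentP) (++-comm [ x ] pre))
  contentQ′ : concat (addAt i k Q) ↭ applyUpTo suc (length (pre ++ [ x ]))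
  contentQ′ rewrite length-∷ʳ pre x | sym (applyUpTo-∷ʳ suc (length pre)) =
    ↭-trans (addAt-content i k Q) (↭-trans (prep i contentQ) (++-comm [ i ] (applyUpTo suc (length pre))))
  uniqueP′ : Unique (concat P′)
  uniqueP′ = unique-↭ (↭-sym contentP′)
    (unique-++ˡ (pre ++ [ x ]) (subst Unique (sym (++-assoc pre [ x ] xs)) u))
  fresh : ∀ m → m ∈ concat Q → letter ws m ≢ x
  fresh m m∈ Wm≡x =
    unique-++-disjoint pre u (subst (_∈ pre) Wm≡x (letter-prefix pre (x ∷ xs) (∈-resp-↭ contentQ m∈)))
      (here refl)
  columnsAgree′ : ∀ b′ l′ → b ≡ b′ → l ≡ l′ → b′ ∨ l′ ≡ false →
                  ∀ j → map (letter ws) (column j (addAt i k Q)) ↭ column j P′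
  columnsAgree′ false false refl refl _ =
    columnsAgree-ins-vertical (letter ws) x i sameShape (letter-next pre x xs) e (columnsAgree refl)
  obstruction′ : ∀ b′ l′ → b ≡ b′ → l ≡ l′ → b′ ∨ l′ ≡ true →
                 Obstruction (letter ws) P′ (addAt i k Q)
  obstruction′ true  _    refl _    _ =
    obstruction-ins (letter ws) x i tableau e fresh (obstruction refl)
  obstruction′ false true refl refl _ =
    obstruction-ins-lateral (letter ws) x i tableau uniqueP′ e (columnsAgree refl)

invariant-run : ∀ ws xs pre i {P Q b} → i ≡ suc (length pre) → ws ≡ pre ++ xs → Unique ws →
  Invariant ws pre P Q b →
  let P′ , Q′ , b′ = schenstedGo i xs P Q b in Invariant ws ws P′ Q′ b′
invariant-run ws [] pre _ {P} {Q} {b} _ ws≡pre _ inv =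
  subst (λ t → Invariant ws t P Q b) (sym (trans ws≡pre (++-identityʳ pre))) inv
invariant-run ws (x ∷ xs) pre _ {P} refl ws≡pre u inv with ins nothing x P in e
... | P′ , k , l =
  invariant-run ws xs (pre ++ [ x ]) _ (cong suc (sym (length-∷ʳ pre x)))
    (trans ws≡pre (sym (++-assoc pre [ x ] xs))) u (invariant-step ws pre x xs ws≡pre u inv e)

columnStrict-length : ∀ r r′ → ColumnStrict r r′ → length r′ ≤ length r
columnStrict-length r r′ strict = ≮⇒≥ λ n<n′ → no-cell (nth-<-length (length r) r′ n<n′)
  where
  no-cell : ¬ (∃ λ z → nth (length r) r′ ≡ just z)
  no-cell (z , nz) with strict (length r) z nz
  ... | a , na , _ with trans (sym na) (nth-≥-length (length r) r ≤-refl)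
  ... | ()

tableau-rows-≤ : ∀ T → IsTableau T → All (_≤ rowLen₁ T) (map length T)
tableau-rows-≤ []                _              = All.[]
tableau-rows-≤ (r ∷ [])          _              = ≤-refl All.∷ All.[]
tableau-rows-≤ (r ∷ rs@(r′ ∷ _)) (strict , tab) =
  ≤-refl All.∷ All.map (λ ≤n′ → ≤-trans ≤n′ (columnStrict-length r r′ strict))
                       (tableau-rows-≤ rs tab)

rowLen₁-sameShape : ∀ (T T′ : Tab) → map length T ≡ map length T′ → rowLen₁ T ≡ rowLen₁ T′
rowLen₁-sameShape []      []       _  = refl
rowLen₁-sameShape (r ∷ T) (r′ ∷ T′) eq = proj₁ (∷-injective eq)

column-length-sameShape : ∀ j (T T′ : Tab) → map length T ≡ map length T′ →
                          length (column j T) ≡ length (column j T′)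
column-length-sameShape j []       []         _  = refl
column-length-sameShape j (r ∷ T)  (r′ ∷ T′) eq
  rewrite column-∷ j r T | column-∷ j r′ T′ | length-++ (fromMaybe (nth j r)) {column j T}
        | length-++ (fromMaybe (nth j r′)) {column j T′} =
  cong₂ _+_ (cell-length (proj₁ (∷-injective eq)))
            (column-length-sameShape j T T′ (proj₂ (∷-injective eq)))
  where
  cell-length : length r ≡ length r′ → length (fromMaybe (nth j r)) ≡ length (fromMaybe (nth j r′))
  cell-length n≡n′ with j <? length r
  ... | yes j<n rewrite proj₂ (nth-<-length j r j<n)
                      | proj₂ (nth-<-length j r′ (subst (j <_) n≡n′ j<n)) = refl
  ... | no j≮n rewrite nth-≥-length j r (≮⇒≥ j≮n)
                     | nth-≥-length j r′ (subst (_≤ j) n≡n′ (≮⇒≥ j≮n)) = refl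

concat-map-++ : ∀ (f g : ℕ → List ℕ) js →
                concat (map (λ j → f j ++ g j) js) ↭ concat (map f js) ++ concat (map g js)
concat-map-++ f g []       = ↭-refl
concat-map-++ f g (j ∷ js) =
  subst₂ _↭_ (sym (++-assoc (f j) (g j) _)) (sym (++-assoc (f j) (concat (map f js)) _))
    (++⁺ˡ (f j) (↭-trans (++⁺ˡ (g j) (concat-map-++ f g js)) (shifts (g j) (concat (map f js)))))

concat-cells : ∀ (r : List ℕ) L → length r ≤ L →
               concat (applyUpTo (λ j → fromMaybe (nth j r)) L) ≡ r
concat-cells []      zero    _         = refl
concat-cells []      (suc L) _         = concat-cells [] L z≤n
concat-cells (x ∷ r) (suc L) (s≤s n≤L) = cong (x ∷_) (concat-cells r L n≤L)

concat-columns : ∀ T L → All (_≤ L) (map length T) →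
                 concat (map (λ j → column j T) (upTo L)) ↭ concat T
concat-columns []       L _ =
  ↭-reflexive (trans (cong concat (map-applyUpTo id _ L)) (concat-cells [] L z≤n))
concat-columns (r ∷ rs) L (n≤L All.∷ rows≤L) = begin
  concat (map (λ j → column j (r ∷ rs)) (upTo L))
    ≡⟨ cong concat (map-cong (λ j → column-∷ j r rs) (upTo L)) ⟩
  concat (map (λ j → fromMaybe (nth j r) ++ column j rs) (upTo L))
    ↭⟨ concat-map-++ (λ j → fromMaybe (nth j r)) (λ j → column j rs) (upTo L) ⟩
  concat (map (λ j → fromMaybe (nth j r)) (upTo L)) ++ concat (map (λ j → column j rs) (upTo L))
    ≡⟨ cong (_++ _) (trans (cong concat (map-applyUpTo id _ L)) (concat-cells r L n≤L)) ⟩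
  r ++ concat (map (λ j → column j rs) (upTo L))
    ↭⟨ ++⁺ˡ r (concat-columns rs L rows≤L) ⟩
  r ++ concat rs ∎
  where open PermutationReasoning

column-index-< : ∀ c T {L v} → All (_≤ L) (map length T) → v ∈ column c T → c < L
column-index-< c (r ∷ rs) (n≤L All.∷ rows≤L) m with ∈-column-∷⁻ c r rs m
... | inj₁ nv = <-≤-trans (nth-just⇒< c r nv) n≤L
... | inj₂ m′ = column-index-< c rs rows≤L m′

-- Coefficients

coeffWhere : (Monomial → Bool) → Poly → ℤ
coeffWhere g []            = + 0
coeffWhere g ((a , m) ∷ p) = (if g m then a else + 0) +ℤ coeffWhere g p

coeff≡coeffWhere : ∀ M p → coeff M p ≡ coeffWhere (sameMon M) p
coeff≡coeffWhere M []            = refl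
coeff≡coeffWhere M ((a , m) ∷ p) = cong ((if sameMon M m then a else + 0) +ℤ_) (coeff≡coeffWhere M p)

coeffWhere-cong : ∀ f g p → (∀ t → t ∈ p → f (proj₂ t) ≡ g (proj₂ t)) →
                  coeffWhere f p ≡ coeffWhere g p
coeffWhere-cong f g []            _   = refl
coeffWhere-cong f g ((a , m) ∷ p) f≡g rewrite f≡g (a , m) (here refl) =
  cong ((if g m then a else + 0) +ℤ_) (coeffWhere-cong f g p (λ t t∈p → f≡g t (there t∈p)))

coeffWhere-++ : ∀ g p q → coeffWhere g (p ++ q) ≡ coeffWhere g p +ℤ coeffWhere g q
coeffWhere-++ g []            q = sym (ℤ.+-identityˡ (coeffWhere g q))
coeffWhere-++ g ((a , m) ∷ p) q =
  trans (cong ((if g m then a else + 0) +ℤ_) (coeffWhere-++ g p q))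
        (sym (ℤ.+-assoc (if g m then a else + 0) (coeffWhere g p) (coeffWhere g q)))

coeffWhere-none : ∀ g p → (∀ t → t ∈ p → g (proj₂ t) ≡ false) → coeffWhere g p ≡ + 0
coeffWhere-none g []            _ = refl
coeffWhere-none g ((a , m) ∷ p) none rewrite none (a , m) (here refl) =
  trans (ℤ.+-identityˡ _) (coeffWhere-none g p (λ t t∈p → none t (there t∈p)))

Multiplicative : (Monomial → Bool) → Set
Multiplicative g = ∀ m m′ → g (m ++ m′) ≡ g m ∧ g m′

if-∧-* : ∀ (x y : Bool) (a b : ℤ) →
  (if x ∧ y then a *ℤ b else + 0) ≡ (if x then a else + 0) *ℤ (if y then b else + 0)
if-∧-* true  true  a b = refl
if-∧-* true  false a b = sym (ℤ.*-zeroʳ a)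
if-∧-* false y     a b = refl

-- The scaling map is passed as h because mulPoly builds it with a pattern lambda.
coeffWhere-scale : ∀ g → Multiplicative g → ∀ a m (h : ℤ × Monomial → ℤ × Monomial) →
  (∀ b m′ → h (b , m′) ≡ (a *ℤ b , m ++ m′)) →
  ∀ q → coeffWhere g (map h q) ≡ (if g m then a else + 0) *ℤ coeffWhere g q
coeffWhere-scale g mult a m h h≡ []             = sym (ℤ.*-zeroʳ (if g m then a else + 0))
coeffWhere-scale g mult a m h h≡ ((b , m′) ∷ q) rewrite h≡ b m′ | mult m m′ =
  trans (cong₂ _+ℤ_ (if-∧-* (g m) (g m′) a b) (coeffWhere-scale g mult a m h h≡ q))
        (sym (ℤ.*-distribˡ-+ (if g m then a else + 0) (if g m′ then b else + 0) (coeffWhere g q)))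

coeffWhere-mulPoly : ∀ g → Multiplicative g →
  ∀ p q → coeffWhere g (mulPoly p q) ≡ coeffWhere g p *ℤ coeffWhere g q
coeffWhere-mulPoly g mult []            q = refl
coeffWhere-mulPoly g mult ((a , m) ∷ p) q =
  trans (coeffWhere-++ g (map _ q) (mulPoly p q))
    (trans (cong₂ _+ℤ_ (coeffWhere-scale g mult a m _ (λ b m′ → refl) q)
                       (coeffWhere-mulPoly g mult p q))
      (sym (ℤ.*-distribʳ-+ (coeffWhere g q) (if g m then a else + 0) (coeffWhere g p))))

productℤ : List ℤ → ℤ
productℤ = foldr _*ℤ_ (+ 1)

coeffWhere-product : ∀ g → Multiplicative g → g [] ≡ true →
  ∀ Fs → coeffWhere g (foldr mulPoly onePoly Fs) ≡ productℤ (map (coeffWhere g) Fs)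
coeffWhere-product g mult g[] []       rewrite g[] = refl
coeffWhere-product g mult g[] (F ∷ Fs) =
  trans (coeffWhere-mulPoly g mult F _) (cong (coeffWhere g F *ℤ_) (coeffWhere-product g mult g[] Fs))

productℤ-zero : ∀ xs → + 0 ∈ xs → productℤ xs ≡ + 0
productℤ-zero (x ∷ xs) (here refl) = refl
productℤ-zero (x ∷ xs) (there 0∈)  rewrite productℤ-zero xs 0∈ = ℤ.*-zeroʳ x

productℤ-nonzero : ∀ xs → All (_≢ + 0) xs → productℤ xs ≢ + 0
productℤ-nonzero []       _               ()
productℤ-nonzero (x ∷ xs) (x≢0 All.∷ xs≢0) eq with ℤ.i*j≡0⇒i≡0∨j≡0 x eq
... | inj₁ x≡0 = x≢0 x≡0
... | inj₂ p≡0 = productℤ-nonzero xs xs≢0 p≡0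

∧-≡-true : ∀ {a b} → a ∧ b ≡ true → a ≡ true × b ≡ true
∧-≡-true {true} {true} _ = refl , refl

allB-∈ : ∀ f L {v} → allB f L ≡ true → v ∈ L → f v ≡ true
allB-∈ f (u ∷ L) all (here refl) = proj₁ (∧-≡-true all)
allB-∈ f (u ∷ L) all (there v∈) = allB-∈ f L (proj₂ (∧-≡-true {f u} all)) v∈

allB-tabulate : ∀ f L → (∀ v → v ∈ L → f v ≡ true) → allB f L ≡ true
allB-tabulate f []      _   = refl
allB-tabulate f (u ∷ L) all rewrite all u (here refl) = allB-tabulate f L (λ v v∈ → all v (there v∈))

allB-false⇒witness : ∀ f L → allB f L ≡ false → ∃ λ v → v ∈ L × f v ≡ false
allB-false⇒witness f (u ∷ L) notAll with f u in fu
... | false = u , here refl , fu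
... | true  = let v , v∈ , fv = allB-false⇒witness f L notAll in v , there v∈ , fv

allB-false : ∀ f L {v} → v ∈ L → f v ≡ false → allB f L ≡ false
allB-false f L v∈ fv with allB f L in all
... | false = refl
... | true with () ← trans (sym fv) (allB-∈ f L all v∈)

allB-++ : ∀ f L L′ → allB f (L ++ L′) ≡ allB f L ∧ allB f L′
allB-++ f []      L′ = refl
allB-++ f (u ∷ L) L′ rewrite allB-++ f L L′ with f u
... | true  = refl
... | false = refl

eqVar-true⇒≡ : ∀ v u → eqVar v u ≡ true → v ≡ u
eqVar-true⇒≡ (a , b) (c , d) eq =
  let a≡c , b≡d = ∧-≡-true {a ≡ᵇ c} eq in
  cong₂ _,_ (≡ᵇ-true⇒≡ a c a≡c) (≡ᵇ-true⇒≡ b d b≡d)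

eqVar-refl : ∀ v → eqVar v v ≡ true
eqVar-refl (a , b) rewrite ≡ᵇ-refl a | ≡ᵇ-refl b = refl

countVar-↭ : ∀ v {L L′ : Monomial} → L ↭ L′ → countVar v L ≡ countVar v L′
countVar-↭ v ↭.refl         = refl
countVar-↭ v (↭.prep x p)   = cong₂ _+_ refl (countVar-↭ v p)
countVar-↭ v (↭.swap x y p) rewrite countVar-↭ v p =
  x∙yz≈y∙xz +-commutativeSemigroup (if eqVar v x then 1 else 0) (if eqVar v y then 1 else 0) _
countVar-↭ v (↭.trans p q)  = trans (countVar-↭ v p) (countVar-↭ v q)

∈⇒countVar≢0 : ∀ v (L : Monomial) → v ∈ L → countVar v L ≢ 0
∈⇒countVar≢0 v (u ∷ L) (here refl) rewrite eqVar-refl v = λ ()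
∈⇒countVar≢0 v (u ∷ L) (there v∈) with eqVar v u
... | true  = λ ()
... | false = ∈⇒countVar≢0 v L v∈

countVar≢0⇒∈ : ∀ v (L : Monomial) → countVar v L ≢ 0 → v ∈ L
countVar≢0⇒∈ v []      c≢0 = ⊥-elim (c≢0 refl)
countVar≢0⇒∈ v (u ∷ L) c≢0 with eqVar v u in v≟u
... | true  = here (eqVar-true⇒≡ v u v≟u)
... | false = there (countVar≢0⇒∈ v L c≢0)

occurs : Var → Monomial → Bool
occurs v M = not (countVar v M ≡ᵇ 0)

occurs⇒∈ : ∀ v M → occurs v M ≡ true → v ∈ M
occurs⇒∈ v M occ with countVar v M in c
... | suc _ = countVar≢0⇒∈ v M (λ c≡0 → 0≢1+n (trans (sym c≡0) c))

∈⇒occurs : ∀ v M → v ∈ M → occurs v M ≡ true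
∈⇒occurs v M v∈ with countVar v M in c
... | zero  = ⊥-elim (∈⇒countVar≢0 v M v∈ c)
... | suc _ = refl

supportedIn : Monomial → Monomial → Bool
supportedIn Z M = allB (λ v → occurs v Z) M

supportedIn-multiplicative : ∀ Z → Multiplicative (supportedIn Z)
supportedIn-multiplicative Z = allB-++ (λ v → occurs v Z)

columnsOf : Monomial → List ℕ
columnsOf = map proj₂

graph : (ℕ → ℕ) → List ℕ → Monomial
graph W ks = map (λ k → (W k , k)) ks

∈-graph⁻ : ∀ W ks {a k} → (a , k) ∈ graph W ks → a ≡ W k
∈-graph⁻ W ks v∈ with ∈-map⁻ (λ k → (W k , k)) v∈
... | _ , _ , refl = refl

-- Once the column indices are fixed, the only monomial supported in a graph is the graph itself.
sameMon-graph : ∀ W ks M → columnsOf M ↭ ks → sameMon (graph W ks) M ≡ supportedIn (graph W ks) M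
sameMon-graph W ks M cols with supportedIn (graph W ks) M in supp
... | true = allB-tabulate _ (graph W ks ++ M)
  (λ v _ → trans (cong (countVar v (graph W ks) ≡ᵇ_) (countVar-↭ v M↭graph))
                 (≡ᵇ-refl (countVar v (graph W ks))))
  where
  on-graph : All (λ v → (W (proj₂ v) , proj₂ v) ≡ v) M
  on-graph = All.tabulate λ {(a , k)} v∈ →
    cong (_, k) (sym (∈-graph⁻ W ks (occurs⇒∈ (a , k) (graph W ks) (allB-∈ _ M supp v∈))))
  M↭graph : M ↭ graph W ks
  M↭graph = subst (_↭ graph W ks) (trans (sym (map-∘ M)) (map-id-local on-graph))
                  (map⁺ (λ k → (W k , k)) cols)
... | false with allB-false⇒witness _ M supp
...   | v , v∈M , v∉graph = allB-false _ (graph W ks ++ M) (∈-++⁺ʳ (graph W ks) v∈M) counts-differ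
  where
  absent : countVar v (graph W ks) ≡ 0
  absent with countVar v (graph W ks) ≟ 0
  ... | yes c≡0 = c≡0
  ... | no  c≢0
    with () ← trans (sym v∉graph) (∈⇒occurs v (graph W ks) (countVar≢0⇒∈ v (graph W ks) c≢0))
  counts-differ : (countVar v (graph W ks) ≡ᵇ countVar v M) ≡ false
  counts-differ rewrite absent with countVar v M in c
  ... | zero  = ⊥-elim (∈⇒countVar≢0 v M v∈M c)
  ... | suc _ = refl

∈-mulPoly⁻ : ∀ p q {t} → t ∈ mulPoly p q →
  ∃ λ t₁ → ∃ λ t₂ → t₁ ∈ p × t₂ ∈ q × proj₂ t ≡ proj₂ t₁ ++ proj₂ t₂
∈-mulPoly⁻ ((a , m) ∷ p) q t∈ with ∈-++⁻ (map _ q) t∈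
... | inj₁ t∈₁ with ∈-map⁻ _ t∈₁
...   | (b , m′) , t₂∈ , refl = (a , m) , (b , m′) , here refl , t₂∈ , refl
∈-mulPoly⁻ ((a , m) ∷ p) q t∈ | inj₂ t∈₂ =
  let t₁ , t₂ , t₁∈ , t₂∈ , eq = ∈-mulPoly⁻ p q t∈₂ in t₁ , t₂ , there t₁∈ , t₂∈ , eq

insEverywhere-sound : ∀ x (σ : List ℕ) {π} → π ∈ insEverywhere x σ → π ↭ x ∷ σ
insEverywhere-sound x []      (here refl) = ↭-refl
insEverywhere-sound x (y ∷ σ) (here refl) = ↭-refl
insEverywhere-sound x (y ∷ σ) (there π∈) with ∈-map⁻ (y ∷_) π∈
... | π′ , π′∈ , refl = ↭-trans (prep y (insEverywhere-sound x σ π′∈)) (swap y x ↭-refl)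

perms-sound : ∀ (xs : List ℕ) {π} → π ∈ perms xs → π ↭ xs
perms-sound []       (here refl) = ↭-refl
perms-sound (x ∷ xs) π∈ with ∈-concat⁻′ (map (insEverywhere x) (perms xs)) π∈
... | ys , π∈ys , ys∈ with ∈-map⁻ (insEverywhere x) ys∈
...   | σ , σ∈ , refl = ↭-trans (insEverywhere-sound x σ π∈ys) (prep x (perms-sound xs σ∈))

insEverywhere-complete : ∀ x (as bs : List ℕ) → as ++ x ∷ bs ∈ insEverywhere x (as ++ bs)
insEverywhere-complete x []       []       = here refl
insEverywhere-complete x []       (b ∷ bs) = here refl
insEverywhere-complete x (a ∷ as) bs       = there (∈-map⁺ (a ∷_) (insEverywhere-complete x as bs))

perms-complete : ∀ (xs : List ℕ) {π} → π ↭ xs → π ∈ perms xs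
perms-complete []       π↭ rewrite ↭-empty-inv π↭ = here refl
perms-complete (x ∷ xs) π↭ with ∈-∃++ (∈-resp-↭ (↭-sym π↭) (here refl))
... | as , bs , refl =
  ∈-concat⁺′ (insEverywhere-complete x as bs)
    (∈-map⁺ (insEverywhere x) (perms-complete xs (drop-mid as [] π↭)))

perms-upTo-length : ∀ L {π} → π ∈ perms (upTo L) → length π ≡ L
perms-upTo-length L π∈ = trans (↭-length (perms-sound (upTo L) π∈)) (length-upTo L)

perms-upTo-< : ∀ L {π t} → π ∈ perms (upTo L) → t ∈ π → t < L
perms-upTo-< L π∈ t∈ = ∈-upTo⁻ (∈-resp-↭ (perms-sound (upTo L) π∈) t∈)

nthD-suc : ∀ x (xs : List ℕ) t → nthD (x ∷ xs) (suc t) ≡ nthD xs t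
nthD-suc x xs t with nth t xs
... | just _  = refl
... | nothing = refl

nthD-∈ : ∀ (rs : List ℕ) j → j < length rs → nthD rs j ∈ rs
nthD-∈ rs j j<n =
  let a , na = nth-<-length j rs j<n in subst (_∈ rs) (sym (nthD-just rs j na)) (nth-just⇒∈ j rs na)

nthD-injective : ∀ (rs : List ℕ) i j → Unique rs → i < length rs → j < length rs →
                 nthD rs i ≡ nthD rs j → i ≡ j
nthD-injective rs i j u i<n j<n eq =
  let a , na = nth-<-length i rs i<n
      b , nb = nth-<-length j rs j<n
      a≡b = trans (sym (nthD-just rs i na)) (trans eq (nthD-just rs j nb))
  in nth-injective rs i j u na (subst (λ z → nth j rs ≡ just z) (sym a≡b) nb)

position : List ℕ → ℕ → ℕ
position []       v = 0
position (a ∷ as) v = if a ≡ᵇ v then 0 else suc (position as v)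

nthD-position : ∀ (rs : List ℕ) {v} → v ∈ rs → nthD rs (position rs v) ≡ v
nthD-position (a ∷ as) {v} v∈ with a ≡ᵇ v in a≟v
... | true = ≡ᵇ-true⇒≡ a v a≟v
... | false with v∈
...   | here refl with () ← trans (sym a≟v) (≡ᵇ-refl a)
...   | there v∈′ = trans (nthD-suc a as (position as v)) (nthD-position as v∈′)

map-position : ∀ (rs : List ℕ) → Unique rs → map (position rs) rs ≡ upTo (length rs)
map-position []       _          = refl
map-position (a ∷ as) (a∉ ∷ u) rewrite ≡ᵇ-refl a = cong (0 ∷_) (begin
  map (position (a ∷ as)) as     ≡⟨ map-cong-local (All.tabulate λ v∈ → shifted (All.lookup a∉ v∈)) ⟩
  map (suc ∘ position as) as     ≡⟨ map-∘ as ⟩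
  map suc (map (position as) as) ≡⟨ cong (map suc) (map-position as u) ⟩
  map suc (upTo (length as))     ≡⟨ map-applyUpTo id suc (length as) ⟩
  applyUpTo suc (length as)      ∎)
  where
  open ≡-Reasoning
  shifted : ∀ {v} → a ≢ v → position (a ∷ as) v ≡ suc (position as v)
  shifted {v} a≢v with a ≡ᵇ v in a≟v
  ... | false = refl
  ... | true  = ⊥-elim (a≢v (≡ᵇ-true⇒≡ a v a≟v))

map-injective-on : ∀ (f : ℕ → ℕ) xs ys → (∀ {a b} → a ∈ xs → b ∈ ys → f a ≡ f b → a ≡ b) →
  map f xs ≡ map f ys → xs ≡ ys
map-injective-on f []       []       _   _  = refl
map-injective-on f (x ∷ xs) (y ∷ ys) inj eq =
  cong₂ _∷_ (inj (here refl) (here refl) (proj₁ (∷-injective eq)))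
            (map-injective-on f xs ys (λ a∈ b∈ → inj (there a∈) (there b∈))
                              (proj₂ (∷-injective eq)))

-- Determinants

zipPairs-columns : ∀ (as cs : List ℕ) → length as ≡ length cs → columnsOf (zipPairs as cs) ≡ cs
zipPairs-columns []       []       _   = refl
zipPairs-columns (a ∷ as) (c ∷ cs) len = cong (c ∷_) (zipPairs-columns as cs (suc-injective len))

∈-zipPairs : ∀ (as cs : List ℕ) {k} → length as ≡ length cs → k ∈ cs →
             ∃ λ a → a ∈ as × (a , k) ∈ zipPairs as cs
∈-zipPairs (a ∷ as) (c ∷ cs) len (here refl) = a , here refl , here refl
∈-zipPairs (a ∷ as) (c ∷ cs) len (there k∈) =
  let a′ , a′∈ , ak∈ = ∈-zipPairs as cs (suc-injective len) k∈ in a′ , there a′∈ , there ak∈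

zipPairs-graph : ∀ (W : ℕ → ℕ) (as cs : List ℕ) → length as ≡ length cs →
  (∀ {a k} → (a , k) ∈ zipPairs as cs → a ≡ W k) → as ≡ map W cs
zipPairs-graph W []       []       _   _       = refl
zipPairs-graph W (a ∷ as) (c ∷ cs) len on-graph =
  cong₂ _∷_ (on-graph (here refl)) (zipPairs-graph W as cs (suc-injective len) (on-graph ∘ there))

zipPairs-map : ∀ (W : ℕ → ℕ) cs → zipPairs (map W cs) cs ≡ graph W cs
zipPairs-map W []       = refl
zipPairs-map W (c ∷ cs) = cong ((W c , c) ∷_) (zipPairs-map W cs)

term-length : ∀ (rs cs : List ℕ) {π} → length rs ≡ length cs → π ∈ perms (upTo (length rs)) →
  length (map (nthD rs) π) ≡ length cs
term-length rs cs {π} len π∈ =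
  trans (length-map (nthD rs) π) (trans (perms-upTo-length (length rs) π∈) len)

detSub-columns : ∀ rs cs {t} → length rs ≡ length cs → t ∈ detSub rs cs →
                 columnsOf (proj₂ t) ≡ cs
detSub-columns rs cs len t∈ with ∈-map⁻ _ t∈
... | π , π∈ , refl = zipPairs-columns (map (nthD rs) π) cs (term-length rs cs len π∈)

product-columns : ∀ (f h : ℕ → List ℕ) js → (∀ j → length (f j) ≡ length (h j)) →
  ∀ {t} → t ∈ foldr mulPoly onePoly (map (λ j → detSub (f j) (h j)) js) →
  columnsOf (proj₂ t) ≡ concat (map h js)
product-columns f h []       len (here refl) = refl
product-columns f h (j ∷ js) len t∈ with ∈-mulPoly⁻ (detSub (f j) (h j)) _ t∈
... | t₁ , t₂ , t₁∈ , t₂∈ , eq rewrite eq =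
  trans (map-++ proj₂ (proj₂ t₁) (proj₂ t₂))
        (cong₂ _++_ (detSub-columns (f j) (h j) (len j) t₁∈) (product-columns f h js len t₂∈))

coeffWhere-single-support : ∀ g (s : List ℕ → ℤ) (M : List ℕ → Monomial) Π π₀ →
  (∀ {π} → π ∈ Π → g (M π) ≡ true → π ≡ π₀) →
  ∃ λ c → coeffWhere g (map (λ π → (s π , M π)) Π) ≡ + c *ℤ s π₀ ×
          (π₀ ∈ Π → g (M π₀) ≡ true → 1 ≤ c)
coeffWhere-single-support g s M []      π₀ _    = 0 , refl , λ ()
coeffWhere-single-support g s M (π ∷ Π) π₀ only
  with coeffWhere-single-support g s M Π π₀ (only ∘ there)
... | c , sum≡ , c≥1 with g (M π) in gπ
...   | true with only (here refl) gπ
...     | refl =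
  suc c , trans (cong (s π +ℤ_) sum≡) (sym (ℤ.suc-* (+ c) (s π))) , λ _ _ → s≤s z≤n
coeffWhere-single-support g s M (π ∷ Π) π₀ only | c , sum≡ , c≥1 | false =
  c , trans (ℤ.+-identityˡ _) sum≡ , c≥1′
  where
  c≥1′ : π₀ ∈ π ∷ Π → g (M π₀) ≡ true → 1 ≤ c
  c≥1′ (here refl) gπ₀ with () ← trans (sym gπ) gπ₀
  c≥1′ (there π₀∈) gπ₀ = c≥1 π₀∈ gπ₀

signℕ-nonzero : ∀ k → signℕ k ≢ + 0
signℕ-nonzero zero          ()
signℕ-nonzero (suc zero)    ()
signℕ-nonzero (suc (suc k)) = signℕ-nonzero k

supportedIn-∈ : ∀ Z M {v} → supportedIn Z M ≡ true → v ∈ M → v ∈ Z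
supportedIn-∈ Z M supp v∈ = occurs⇒∈ _ Z (allB-∈ _ M supp v∈)

-- Every term contains some variable (rs[π b], k), which lies off the graph as W k ∉ rs.
detSub-coeff-zero : ∀ W ks rs cs {k} → length rs ≡ length cs → k ∈ cs → W k ∉ rs →
  coeffWhere (supportedIn (graph W ks)) (detSub rs cs) ≡ + 0
detSub-coeff-zero W ks rs cs {k} len k∈ Wk∉ = coeffWhere-none _ (detSub rs cs) unsupported
  where
  unsupported : ∀ t → t ∈ detSub rs cs → supportedIn (graph W ks) (proj₂ t) ≡ false
  unsupported t t∈ with ∈-map⁻ _ t∈
  ... | π , π∈ , refl with supportedIn (graph W ks) (zipPairs (map (nthD rs) π) cs) in supp
  ...   | false = refl
  ...   | true with ∈-zipPairs (map (nthD rs) π) cs (term-length rs cs len π∈) k∈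
  ...     | a , a∈ , ak∈ with ∈-map⁻ (nthD rs) a∈
  ...       | b , b∈π , refl =
    ⊥-elim (Wk∉ (subst (_∈ rs) (∈-graph⁻ W ks (supportedIn-∈ _ _ supp ak∈))
                               (nthD-∈ rs b (perms-upTo-< (length rs) π∈ b∈π))))

multiple-of-sign-nonzero : ∀ c k → 1 ≤ c → + c *ℤ signℕ k ≢ + 0
multiple-of-sign-nonzero c k c≥1 eq with ℤ.i*j≡0⇒i≡0∨j≡0 (+ c) eq
... | inj₁ c≡0 = <⇒≢ c≥1 (sym (ℤ.+-injective c≡0))
... | inj₂ s≡0 = signℕ-nonzero k s≡0

-- Only the permutation π₀ sending each column entry k to the position of W k in rs is supported.
detSub-coeff-nonzero : ∀ W ks rs cs → map W cs ↭ rs → Unique rs → (∀ {k} → k ∈ cs → k ∈ ks) →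
  coeffWhere (supportedIn (graph W ks)) (detSub rs cs) ≢ + 0
detSub-coeff-nonzero W ks rs cs W[cs]↭rs u cs⊆ks coeff≡0 =
  let c , coeff≡ , c≥1 = coeffWhere-single-support g (signℕ ∘ inversions) term (perms (upTo L)) π₀ only-π₀
  in multiple-of-sign-nonzero c (inversions π₀) (c≥1 (perms-complete (upTo L) π₀↭) supported-π₀)
       (trans (sym coeff≡) coeff≡0)
  where
  L : ℕ
  L = length rs
  len : length rs ≡ length cs
  len = trans (sym (↭-length W[cs]↭rs)) (length-map W cs)
  g : Monomial → Bool
  g = supportedIn (graph W ks)
  term : List ℕ → Monomial
  term π = zipPairs (map (nthD rs) π) cs
  π₀ : List ℕ
  π₀ = map (position rs) (map W cs)
  π₀↭ : π₀ ↭ upTo L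
  π₀↭ = ↭-trans (map⁺ (position rs) W[cs]↭rs) (↭-reflexive (map-position rs u))
  rows-π₀ : map (nthD rs) π₀ ≡ map W cs
  rows-π₀ = trans (sym (map-∘ (map W cs)))
                  (map-id-local (All.tabulate (nthD-position rs ∘ ∈-resp-↭ W[cs]↭rs)))
  supported-π₀ : g (term π₀) ≡ true
  supported-π₀ rewrite rows-π₀ | zipPairs-map W cs = allB-tabulate _ (graph W cs) λ v v∈ →
    let k , k∈ , v≡ = ∈-map⁻ (λ k → (W k , k)) v∈ in
    ∈⇒occurs v (graph W ks)
      (subst (_∈ graph W ks) (sym v≡) (∈-map⁺ (λ k → (W k , k)) (cs⊆ks k∈)))
  only-π₀ : ∀ {π} → π ∈ perms (upTo L) → g (term π) ≡ true → π ≡ π₀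
  only-π₀ {π} π∈ supp = map-injective-on (nthD rs) π π₀
    (λ a∈ b∈ → nthD-injective rs _ _ u (perms-upTo-< L π∈ a∈)
                                      (∈-upTo⁻ (∈-resp-↭ π₀↭ b∈)))
    (trans (zipPairs-graph W (map (nthD rs) π) cs (term-length rs cs len π∈)
             (λ ak∈ → ∈-graph⁻ W ks (supportedIn-∈ _ _ supp ak∈)))
           (sym rows-π₀))

sameShape-rows-≤ : ∀ P Q → IsTableau P → map length P ≡ map length Q →
                   All (_≤ rowLen₁ Q) (map length Q)
sameShape-rows-≤ P Q tab shape =
  subst₂ (λ L ls → All (_≤ L) ls) (rowLen₁-sameShape P Q shape) shape (tableau-rows-≤ P tab)

zipWith-diagonal : ∀ {A B : Set} (f : A → A → B) xs → zipWith f xs xs ≡ map (λ x → f x x) xs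
zipWith-diagonal f []       = refl
zipWith-diagonal f (x ∷ xs) = cong (f x x ∷_) (zipWith-diagonal f xs)

bitableau-columns : ∀ P Q → rowLen₁ P ≡ rowLen₁ Q →
  bitableau P Q ≡ foldr mulPoly onePoly (map (λ j → detSub (column j P) (column j Q)) (upTo (rowLen₁ Q)))
bitableau-columns P Q L≡ rewrite L≡ =
  cong (foldr mulPoly onePoly)
    (trans (zipWith-map detSub (λ j → column j P) (λ j → column j Q) (upTo (rowLen₁ Q)) (upTo (rowLen₁ Q)))
           (zipWith-diagonal (λ i j → detSub (column i P) (column j Q)) (upTo (rowLen₁ Q))))

-- sameMon is not multiplicative, but it agrees with supportedIn on the terms of a bitableau, whose
-- column indices are those of Q.
bitableau-coeff : ∀ W ks P Q → IsTableau P → map length P ≡ map length Q → concat Q ↭ ks →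
  coeff (graph W ks) (bitableau P Q) ≡
  productℤ (map (λ j → coeffWhere (supportedIn (graph W ks)) (detSub (column j P) (column j Q)))
                (upTo (rowLen₁ Q)))
bitableau-coeff W ks P Q tab shape content = begin
  coeff (graph W ks) (bitableau P Q)
    ≡⟨ cong (coeff (graph W ks)) (bitableau-columns P Q (rowLen₁-sameShape P Q shape)) ⟩
  coeff (graph W ks) (foldr mulPoly onePoly Fs)
    ≡⟨ coeff≡coeffWhere (graph W ks) (foldr mulPoly onePoly Fs) ⟩
  coeffWhere (sameMon (graph W ks)) (foldr mulPoly onePoly Fs)
    ≡⟨ coeffWhere-cong _ _ _ (λ t t∈ → sameMon-graph W ks (proj₂ t) (columns-↭ t∈)) ⟩
  coeffWhere (supportedIn (graph W ks)) (foldr mulPoly onePoly Fs)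
    ≡⟨ coeffWhere-product _ (supportedIn-multiplicative (graph W ks)) refl Fs ⟩
  productℤ (map (coeffWhere (supportedIn (graph W ks))) Fs)
    ≡⟨ cong productℤ (sym (map-∘ (upTo L))) ⟩
  productℤ (map (λ j → coeffWhere (supportedIn (graph W ks)) (detSub (column j P) (column j Q))) (upTo L))
    ∎
  where
  open ≡-Reasoning
  L : ℕ
  L = rowLen₁ Q
  Fs : List Poly
  Fs = map (λ j → detSub (column j P) (column j Q)) (upTo L)
  columns-↭ : ∀ {t} → t ∈ foldr mulPoly onePoly Fs → columnsOf (proj₂ t) ↭ ks
  columns-↭ t∈ = subst (_↭ ks) (sym (product-columns (λ j → column j P) (λ j → column j Q) (upTo L)
                   (λ j → column-length-sameShape j P Q shape) t∈))
                   (↭-trans (concat-columns Q L (sameShape-rows-≤ P Q tab shape)) content)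

schensted-parts : ∀ ws → schensted ws ≡ (insTab ws , recTab ws , hasLateralBump ws)
schensted-parts ws with schensted ws
... | _ = refl

schensted-invariant : ∀ ws → Unique ws → Invariant ws ws (insTab ws) (recTab ws) (hasLateralBump ws)
schensted-invariant ws u =
  subst (λ R → Invariant ws ws (proj₁ R) (proj₁ (proj₂ R)) (proj₂ (proj₂ R))) (schensted-parts ws)
    (invariant-run ws ws [] 1 refl refl u (invariant-start ws))

coeff-zero⇔lateral : ∀ ws → Unique ws →
  (coeff (graph (letter ws) (applyUpTo suc (length ws))) (bitableau (insTab ws) (recTab ws)) ≡ + 0)
    ⇔ (hasLateralBump ws ≡ true)
coeff-zero⇔lateral ws u = mk⇔ (zero⇒lateral (hasLateralBump ws) refl) lateral⇒zero
  where
  open Invariant (schensted-invariant ws u)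
  P Q : Tab
  P = insTab ws
  Q = recTab ws
  W : ℕ → ℕ
  W = letter ws
  ks : List ℕ
  ks = applyUpTo suc (length ws)
  factor : ℕ → ℤ
  factor j = coeffWhere (supportedIn (graph W ks)) (detSub (column j P) (column j Q))
  coeff≡ : coeff (graph W ks) (bitableau P Q) ≡ productℤ (map factor (upTo (rowLen₁ Q)))
  coeff≡ = bitableau-coeff W ks P Q tableau sameShape contentQ
  zero⇒lateral : ∀ b → hasLateralBump ws ≡ b → coeff (graph W ks) (bitableau P Q) ≡ + 0 →
                 b ≡ true
  zero⇒lateral true  _        _       = refl
  zero⇒lateral false vertical coeff≡0 =
    ⊥-elim (productℤ-nonzero _ factors≢0 (trans (sym coeff≡) coeff≡0))
    where
    factors≢0 : All (_≢ + 0) (map factor (upTo (rowLen₁ Q)))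
    factors≢0 = All-map⁺ (All.tabulate λ {j} _ →
      detSub-coeff-nonzero W ks (column j P) (column j Q) (columnsAgree vertical j)
        (unique-column j P (unique-↭ (↭-sym contentP) u))
        (λ k∈ → ∈-resp-↭ contentQ (column-⊆-concat j Q k∈)))
  lateral⇒zero : hasLateralBump ws ≡ true → coeff (graph W ks) (bitableau P Q) ≡ + 0
  lateral⇒zero lateral =
    let c , m , m∈c , absent = obstruction lateral
        factor-c≡0 = detSub-coeff-zero W ks (column c P) (column c Q)
                       (column-length-sameShape c P Q sameShape) m∈c (absent c ≤-refl)
        c<L = column-index-< c Q (sameShape-rows-≤ P Q tableau sameShape) m∈c
    in trans coeff≡ (productℤ-zero _ (subst (_∈ map factor (upTo (rowLen₁ Q))) factor-c≡0
                                       (∈-map⁺ factor (∈-upTo⁺ c<L))))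

nthD-tabulate : ∀ {n} (F : Fin n → ℕ) i → nthD (tabulate F) (toℕ i) ≡ F i
nthD-tabulate F fzero    = refl
nthD-tabulate F (fsuc i) =
  trans (nthD-suc (F fzero) (tabulate (F ∘ fsuc)) (toℕ i)) (nthD-tabulate (F ∘ fsuc) i)

tabulate-toℕ : ∀ {A : Set} n (G : ℕ → A) → tabulate (G ∘ toℕ {n}) ≡ applyUpTo G n
tabulate-toℕ zero    G = refl
tabulate-toℕ (suc n) G = cong (G 0 ∷_) (tabulate-toℕ n (G ∘ suc))

module _ {n} (w : Permutation′ n) where

  private
    F : Fin n → ℕ
    F i = suc (toℕ (w ⟨$⟩ʳ i))

  word-tabulate : word w ≡ tabulate F
  word-tabulate = map-tabulate id F

  length-word : length (word w) ≡ n
  length-word = trans (cong length word-tabulate) (length-tabulate F)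

  word-unique : Unique (word w)
  word-unique = Unique.map⁺ F-injective (Unique.allFin⁺ n)
    where
    F-injective : ∀ {i j} → F i ≡ F j → i ≡ j
    F-injective {i} {j} Fi≡Fj =
      trans (sym (inverseˡ w)) (trans (cong (w ⟨$⟩ˡ_) (toℕ-injective (suc-injective Fi≡Fj))) (inverseˡ w))

  zMon≡graph : zMon w ≡ graph (letter (word w)) (applyUpTo suc (length (word w)))
  zMon≡graph rewrite length-word = begin
    zMon w
      ≡⟨ map-tabulate id _ ⟩
    tabulate (λ i → (F i , suc (toℕ i)))
      ≡⟨ tabulate-cong (λ i → cong (_, suc (toℕ i)) (sym (letter-word i))) ⟩
    tabulate (λ i → (nthD (word w) (toℕ i) , suc (toℕ i)))
      ≡⟨ tabulate-toℕ n (λ i → (nthD (word w) i , suc i)) ⟩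
    applyUpTo (λ i → (nthD (word w) i , suc i)) n
      ≡⟨ sym (map-applyUpTo suc _ n) ⟩
    graph (letter (word w)) (applyUpTo suc n) ∎
    where
    open ≡-Reasoning
    letter-word : ∀ i → nthD (word w) (toℕ i) ≡ F i
    letter-word i = trans (cong (λ ws → nthD ws (toℕ i)) word-tabulate) (nthD-tabulate F i)

lemma2p5 : (n : ℕ) (w : Permutation′ n) →
    (coeff (zMon w) (bitableau (insTab (word w)) (recTab (word w))) ≡ + 0)
      ⇔ (hasLateralBump (word w) ≡ true)
lemma2p5 n w rewrite zMon≡graph w = coeff-zero⇔lateral (word w) (word-unique w)
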